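{- Let $q$ be a prime power and let $M$ be a $q\times q$ matrix over $\mathbb{F}_q$ that is a linear $(2,q,q)$-AONT and is in type $\mu$ standard form for some $\mu$. Then $\mu = q$ or $\mu = q-1$.
   Context: A linear $(2,s,q)$-AONT is an invertible $s\times s$ matrix $M$ over $\mathbb{F}_q$ all of whose $2\times 2$ submatrices are invertible (so each row and each column of $M$ contains at most one zero). Such a matrix $M$ is in type $\mu$ standard form if: the zero entries of $M$ are exactly the first $\mu$ entries of the main diagonal (positions $(1,1),\dots,(\mu,\mu)$); if $\mu = 0$, all entries of the first row and first column are $1$; and if $\mu \neq 0$, all entries of the first row and first column are $1$ except the entry in position $(1,1)$, which is $0$. -}

module Defs where

open import Level using (Level; _⊔_; suc)
open import Algebra.Bundles using (CommutativeRing)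
open import Data.Nat using (ℕ; zero; suc; _^_; _<_; _≥_; _≤_)
open import Data.Fin using (Fin; toℕ)
import Data.Fin
import Relation.Nullary
open import Data.Nat.Primality using (Prime)
open import Data.Product using (Σ; ∃; _×_; _,_)
open import Data.Sum using (_⊎_)
open import Relation.Nullary using (¬_)
open import Relation.Binary.Definitions using (Decidable)
open import Relation.Binary.PropositionalEquality using (_≡_)

IsPrimePower : ℕ → Set
IsPrimePower q = Σ ℕ λ p → Σ ℕ λ k → Prime p × k ≥ 1 × q ≡ p ^ k

record Field (c ℓ : Level) : Set (Level.suc (c ⊔ ℓ)) where
  field
    commRing : CommutativeRing c ℓ
  open CommutativeRing commRing public
  field
    0≉1     : ¬ (0# ≈ 1#)
    inverse : ∀ x → ¬ (x ≈ 0#) → Σ Carrier λ y → x * y ≈ 1#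
    _≟_     : Decidable _≈_

record FiniteField (c ℓ : Level) (q : ℕ) : Set (Level.suc (c ⊔ ℓ)) where
  field
    field′ : Field c ℓ
  open Field field′ public
  field
    enum       : Fin q → Carrier
    enum-inj   : ∀ i j → enum i ≈ enum j → i ≡ j
    enum-surj  : ∀ x → Σ (Fin q) λ i → enum i ≈ x

module MatrixDefs {c ℓ : Level} {q : ℕ} (F : FiniteField c ℓ q) where
  open FiniteField F

  Matrix : ℕ → Set c
  Matrix s = Fin s → Fin s → Carrier

  sumF : ∀ {n} → (Fin n → Carrier) → Carrier
  sumF {zero}  f = 0#
  sumF {suc n} f = f Data.Fin.zero + sumF (λ i → f (Data.Fin.suc i))

  _⊗_ : ∀ {s} → Matrix s → Matrix s → Matrix s
  (A ⊗ B) i j = sumF λ k → A i k * B k j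

  identity : ∀ {s} → Matrix s
  identity i j with i Data.Fin.≟ j
  ... | Relation.Nullary.yes _ = 1#
  ... | Relation.Nullary.no  _ = 0#

  _≈ᴹ_ : ∀ {s} → Matrix s → Matrix s → Set ℓ
  A ≈ᴹ B = ∀ i j → A i j ≈ B i j

  Invertible : ∀ {s} → Matrix s → Set (c ⊔ ℓ)
  Invertible {s} M = Σ (Matrix s) λ N → (M ⊗ N) ≈ᴹ identity × (N ⊗ M) ≈ᴹ identity

  -- every 2×2 submatrix (rows i ≠ i', columns j ≠ j') is invertible,
  -- i.e. has nonzero determinant
  All2x2Invertible : ∀ {s} → Matrix s → Set ℓ
  All2x2Invertible M = ∀ i i′ j j′ → ¬ (i ≡ i′) → ¬ (j ≡ j′) →
    ¬ ((M i j * M i′ j′ - M i j′ * M i′ j) ≈ 0#)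

  LinearAONT2 : ∀ s → Matrix s → Set (c ⊔ ℓ)
  LinearAONT2 s M = Invertible M × All2x2Invertible M

  -- type μ standard form (indices 0-based: position (1,1) of the paper is (0,0) here)
  StandardForm : ∀ {s} → ℕ → Matrix s → Set ℓ
  StandardForm {s} μ M =
      μ ≤ s
    ×
      (∀ i j → (M i j ≈ 0#) → (i ≡ j × toℕ i < μ))
    × (∀ i → toℕ i < μ → M i i ≈ 0#)
    × (μ ≡ 0 → ∀ i j → (toℕ i ≡ 0 ⊎ toℕ j ≡ 0) → M i j ≈ 1#)
    × (¬ (μ ≡ 0) → ∀ i j → (toℕ i ≡ 0 ⊎ toℕ j ≡ 0) → ¬ (toℕ i ≡ 0 × toℕ j ≡ 0) → M i j ≈ 1#)

-- If μ ≤ q − 2, the rows μ and μ + 1 of M contain no zero. For two zero-free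
-- rows u, v of length q, the q ratios u j / v j are nonzero, so by pigeonhole
-- two of them coincide among the q − 1 nonzero elements of F_q; the 2×2 minor
-- on those two columns is then singular.
module Submission where

open import Defs
open import Level using (Level)
open import Data.Nat using (ℕ; zero; suc; _+_; _∸_; _≤_; _<_; s≤s; z≤n; _≤?_)
open import Data.Nat.Properties using (<⇒≱; ≰⇒>; n<1+n; n≤1+n; 1+n≢n; <⇒≤; ≤-reflexive; ≤-trans)
open import Data.Fin as Fin using (Fin; toℕ; fromℕ<; punchOut)
open import Data.Fin.Properties using (pigeonhole; punchOut-injective; <⇒≢; toℕ-fromℕ<)
open import Data.Product using (∃₂; _×_; _,_; proj₁; proj₂)
open import Data.Sum using (_⊎_; inj₁; inj₂)
import Data.Sum as Sum
open import Relation.Nullary using (yes; no; contradiction)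
open import Relation.Binary.PropositionalEquality using (_≡_; _≢_; refl)
import Relation.Binary.PropositionalEquality as ≡
import Algebra.Properties.CommutativeSemigroup as CommSemigroupProperties
import Algebra.Properties.Group as GroupProperties
import Relation.Binary.Reasoning.Setoid as SetoidReasoning

module FieldFacts {c ℓ : Level} (F : Field c ℓ) where
  open Field F
  open SetoidReasoning setoid
  open CommSemigroupProperties *-commutativeSemigroup using (interchange)

  *-inverse-nonzero : ∀ {a b b′} → b * b′ ≈ 1# → a ≉ 0# → a * b′ ≉ 0#
  *-inverse-nonzero {a} {b} {b′} bb′≈1 a≉0 ab′≈0 = a≉0 (begin
    a               ≈⟨ sym (*-identityʳ a) ⟩
    a * 1#          ≈⟨ *-congˡ (trans (sym bb′≈1) (*-comm b b′)) ⟩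
    a * (b′ * b)    ≈⟨ sym (*-assoc a b′ b) ⟩
    (a * b′) * b    ≈⟨ *-congʳ ab′≈0 ⟩
    0# * b          ≈⟨ zeroˡ b ⟩
    0#              ∎)

  cross-multiply : ∀ {a b c d b′ d′} → b * b′ ≈ 1# → d * d′ ≈ 1# →
                   a * b′ ≈ c * d′ → a * d ≈ c * b
  cross-multiply {a} {b} {c} {d} {b′} {d′} bb′≈1 dd′≈1 ab′≈cd′ = begin
    a * d                  ≈⟨ sym (*-identityʳ (a * d)) ⟩
    (a * d) * 1#           ≈⟨ *-congˡ (trans (sym bb′≈1) (*-comm b b′)) ⟩
    (a * d) * (b′ * b)     ≈⟨ interchange a d b′ b ⟩
    (a * b′) * (d * b)     ≈⟨ *-cong ab′≈cd′ (*-comm d b) ⟩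
    (c * d′) * (b * d)     ≈⟨ interchange c d′ b d ⟩
    (c * b) * (d′ * d)     ≈⟨ *-congˡ (trans (*-comm d′ d) dd′≈1) ⟩
    (c * b) * 1#           ≈⟨ *-identityʳ (c * b) ⟩
    c * b                  ∎

module _ {c ℓ : Level} {m : ℕ} (F : FiniteField c ℓ (suc m)) where
  open FiniteField F
  open MatrixDefs F
  open FieldFacts field′
  open GroupProperties +-group using (x≈y⇒x∙y⁻¹≈ε)

  nonzero-collision : (f : Fin (suc m) → Carrier) → (∀ j → f j ≉ 0#) →
                      ∃₂ λ j j′ → j ≢ j′ × f j ≈ f j′
  nonzero-collision f f≉0 =
    let j , j′ , j<j′ , collision = pigeonhole (n<1+n m) (λ j → punchOut (index≢zero j))
    in  j , j′ , <⇒≢ j<j′ , same-value (punchOut-injective (index≢zero j) (index≢zero j′) collision)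
    where
    index : Fin (suc m) → Fin (suc m)
    index j = proj₁ (enum-surj (f j))
    zeroIndex : Fin (suc m)
    zeroIndex = proj₁ (enum-surj 0#)
    same-value : ∀ {j j′} → index j ≡ index j′ → f j ≈ f j′
    same-value {j} {j′} eq = trans (sym (proj₂ (enum-surj (f j))))
                             (trans (reflexive (≡.cong enum eq)) (proj₂ (enum-surj (f j′))))
    index≢zero : ∀ j → zeroIndex ≢ index j
    index≢zero j eq = f≉0 j (trans (sym (proj₂ (enum-surj (f j))))
                            (trans (reflexive (≡.cong enum (≡.sym eq))) (proj₂ (enum-surj 0#))))

  zero-free-row-unique : (M : Matrix (suc m)) → All2x2Invertible M → ∀ {i i′} →
                         (∀ j → M i j ≉ 0#) → (∀ j → M i′ j ≉ 0#) → i ≡ i′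
  zero-free-row-unique M minors {i} {i′} u≉0 v≉0 with i Fin.≟ i′
  ... | yes i≡i′ = i≡i′
  ... | no  i≢i′ =
    let j , j′ , j≢j′ , same-ratio = nonzero-collision ratio ratio≉0
    in  contradiction (x≈y⇒x∙y⁻¹≈ε (cross-multiply (inverse-law j) (inverse-law j′) same-ratio))
                      (minors i i′ j j′ i≢i′ j≢j′)
    where
    v⁻¹ : Fin (suc m) → Carrier
    v⁻¹ j = proj₁ (inverse (M i′ j) (v≉0 j))
    inverse-law : ∀ j → M i′ j * v⁻¹ j ≈ 1#
    inverse-law j = proj₂ (inverse (M i′ j) (v≉0 j))
    ratio : Fin (suc m) → Carrier
    ratio j = M i j * v⁻¹ j
    ratio≉0 : ∀ j → ratio j ≉ 0#
    ratio≉0 j = *-inverse-nonzero (inverse-law j) (u≉0 j)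

standardForm-zero-free-row : ∀ {c ℓ q μ} (F : FiniteField c ℓ q) {M : MatrixDefs.Matrix F q} →
  MatrixDefs.StandardForm F μ M → ∀ i → μ ≤ toℕ i → ∀ j → FiniteField._≉_ F (M i j) (FiniteField.0# F)
standardForm-zero-free-row F (_ , zeros , _) i μ≤i j Mij≈0 = <⇒≱ (proj₂ (zeros i j Mij≈0)) μ≤i

≤∧<2+⇒≡⊎≡∸1 : ∀ {m n} → m ≤ n → n < 2 + m → m ≡ n ⊎ m ≡ n ∸ 1
≤∧<2+⇒≡⊎≡∸1 {zero}  {zero}        _         _              = inj₁ refl
≤∧<2+⇒≡⊎≡∸1 {zero}  {suc zero}    _         _              = inj₂ refl
≤∧<2+⇒≡⊎≡∸1 {zero}  {suc (suc n)} _         (s≤s (s≤s ()))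
≤∧<2+⇒≡⊎≡∸1 {suc m} {suc zero}    (s≤s z≤n) _              = inj₁ refl
≤∧<2+⇒≡⊎≡∸1 {suc m} {suc (suc n)} (s≤s m≤n) (s≤s n<2+m)    =
  Sum.map (≡.cong suc) (≡.cong suc) (≤∧<2+⇒≡⊎≡∸1 m≤n n<2+m)

lemma12 : {c ℓ : Level} (q : ℕ) → IsPrimePower q → (F : FiniteField c ℓ q) →
    (M : MatrixDefs.Matrix F q) → MatrixDefs.LinearAONT2 F q M →
    (μ : ℕ) → MatrixDefs.StandardForm F μ M →
    μ ≡ q ⊎ μ ≡ q ∸ 1
lemma12 q _ F M _ μ form@(μ≤q , _) with 2 + μ ≤? q
... | no  2+μ≰q = ≤∧<2+⇒≡⊎≡∸1 μ≤q (≰⇒> 2+μ≰q)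
lemma12 (suc m) _ F M (_ , minors) μ form | yes 2+μ≤q = contradiction (≡.sym μ≡1+μ) 1+n≢n
  where
  rowμ rowμ+1 : Fin (suc m)
  rowμ   = fromℕ< (<⇒≤ 2+μ≤q)
  rowμ+1 = fromℕ< 2+μ≤q
  toℕ-rowμ : toℕ rowμ ≡ μ
  toℕ-rowμ = toℕ-fromℕ< (<⇒≤ 2+μ≤q)
  toℕ-rowμ+1 : toℕ rowμ+1 ≡ suc μ
  toℕ-rowμ+1 = toℕ-fromℕ< 2+μ≤q
  rowμ≡rowμ+1 : rowμ ≡ rowμ+1
  rowμ≡rowμ+1 = zero-free-row-unique F M minors
    (standardForm-zero-free-row F form rowμ   (≤-reflexive (≡.sym toℕ-rowμ)))
    (standardForm-zero-free-row F form rowμ+1 (≤-trans (n≤1+n μ) (≤-reflexive (≡.sym toℕ-rowμ+1))))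
  μ≡1+μ : μ ≡ suc μ
  μ≡1+μ = ≡.trans (≡.sym toℕ-rowμ) (≡.trans (≡.cong toℕ rowμ≡rowμ+1) toℕ-rowμ+1)
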